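{- Let $\mathcal P$ be a finite non-flat vertex-faithful regular polyhedron of type $\{p,q\}$ with $q$ even, whose automorphism group $\langle\rho_0,\rho_1,\rho_2\rangle$ satisfies the relation $\rho_0\sigma_2^{q/2}\rho_0=\rho_2\sigma_2^{q/2}$, where $\sigma_2=\rho_1\rho_2$. If $\mathcal Q$ is a regular polyhedron that covers $\mathcal P$ and has the same number of vertices as $\mathcal P$, then $\mathcal Q$ is isomorphic to $\mathcal P$. In particular, for $q\geq 6$ with $q/2$ odd, there is no non-vertex-faithful regular polyhedron whose vertex-faithful quotient is $(\{4,4\}_{(q/2,0)})^{\pi\delta}$.
   Context: An abstract regular polyhedron has flag-transitive automorphism group $\Gamma=\langle\rho_0,\rho_1,\rho_2\rangle$ generated by distinguished involutions ($\rho_i$ changes only the rank-$i$ face of a base flag); type $\{p,q\}$ means $\rho_0\rho_1$ has order $p$ and $\rho_1\rho_2$ has order $q$. Flat means every facet is incident to every vertex; vertex-faithful means $\Gamma$ acts faithfully on vertices. $\mathcal Q$ covers $\mathcal P$ if there is an epimorphism $\Gamma(\mathcal Q)\to\Gamma(\mathcal P)$ sending distinguished generators to distinguished generators. For a regular polyhedron $\mathcal Q$, its vertex-faithful quotient is the regular polyhedron with automorphism group $\Gamma(\mathcal Q)/N$, where $N$ is the normal core of $\langle\rho_1,\rho_2\rangle$ (the kernel of the action on vertices). $\{4,4\}_{(s,0)}$ is the regular toroidal map obtained from the square tessellation of the plane by factoring out translations by $(s,0)$ and $(0,s)$; $\mathcal K^{\pi}$ is the Petrie dual (faces replaced by Petrie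 polygons) and $\mathcal K^\delta$ the dual; $(\{4,4\}_{(s,0)})^{\pi\delta}$ is the dual of the Petrial of $\{4,4\}_{(s,0)}$. -}

module Defs where

open import Level using (Level; _⊔_) renaming (suc to lsuc)
open import Algebra.Bundles using (Group)
open import Algebra.Structures using (IsGroup; IsMonoid; IsSemigroup; IsMagma)
import Algebra.Morphism.Structures as MS
open import Data.Nat using (ℕ; zero; suc; _<_)
open import Data.Fin using (Fin; zero; suc; opposite)
open import Data.Fin.Properties using (opposite-involutive)
open import Data.Fin.Subset using (Subset; _∈_; _∩_; ⊤; inside; outside)
open import Data.Vec using ([]; _∷_)
open import Data.List using (List; []; _∷_; _++_; reverse; [_])
open import Data.List.Properties using (++-assoc; ++-identityʳ; unfold-reverse; reverse-involutive)
open import Data.List.Relation.Unary.All using (All)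
open import Data.Product using (Σ; ∃; _×_; _,_)
open import Relation.Nullary using (¬_)
open import Relation.Binary.PropositionalEquality
  using (_≡_; refl; sym; trans; cong; cong₂; isEquivalence)

i0 i1 i2 : Fin 3
i0 = zero
i1 = suc zero
i2 = suc (suc zero)

module _ {c ℓ : Level} (G : Group c ℓ) where
  open Group G

  pow : Carrier → ℕ → Carrier
  pow g zero    = ε
  pow g (suc n) = g ∙ pow g n

  HasOrder : Carrier → ℕ → Set ℓ
  HasOrder g n = (0 < n) × (pow g n ≈ ε) × (∀ k → 0 < k → k < n → ¬ (pow g k ≈ ε))

  eval : (Fin 3 → Carrier) → List (Fin 3) → Carrier
  eval ρ []      = ε
  eval ρ (i ∷ w) = ρ i ∙ eval ρ w

  InSub : (Fin 3 → Carrier) → Subset 3 → Carrier → Set ℓ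
  InSub ρ I g = Σ (List (Fin 3)) (λ w → All (_∈ I) w × (eval ρ w ≈ g))

  -- index sets {1,2} (vertex stabiliser) and {0,1} (facet stabiliser)
  V₁₂ F₀₁ : Subset 3
  V₁₂ = outside ∷ inside ∷ inside ∷ []
  F₀₁ = inside ∷ inside ∷ outside ∷ []

  -- Γ = ⟨ρ₀,ρ₁,ρ₂⟩ is a string C-group of rank 3 (i.e. the automorphism
  -- group of an abstract regular polyhedron, with its distinguished generators)
  record IsStringC (ρ : Fin 3 → Carrier) : Set (c ⊔ ℓ) where
    field
      generates    : ∀ g → InSub ρ ⊤ g
      involution   : ∀ i → (ρ i ∙ ρ i) ≈ ε
      nontrivial   : ∀ i → ¬ (ρ i ≈ ε)
      string       : ((ρ i0 ∙ ρ i2) ∙ (ρ i0 ∙ ρ i2)) ≈ ε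
      intersection : ∀ I J g → InSub ρ I g → InSub ρ J g → InSub ρ (I ∩ J) g

  Finite : Set (c ⊔ ℓ)
  Finite = Σ ℕ (λ n → Σ (Fin n → Carrier) (λ f → ∀ g → Σ (Fin n) (λ i → f i ≈ g)))

  -- vertices = left cosets of ⟨ρ₁,ρ₂⟩, facets = left cosets of ⟨ρ₀,ρ₁⟩;
  -- a vertex and a facet are incident iff the cosets meet.
  -- Flat: every facet is incident with every vertex.
  Flat : (Fin 3 → Carrier) → Set (c ⊔ ℓ)
  Flat ρ = ∀ a b → Σ Carrier (λ g → InSub ρ V₁₂ (a ⁻¹ ∙ g) × InSub ρ F₀₁ (b ⁻¹ ∙ g))

  -- g acts trivially on the vertices:  g a⟨ρ₁,ρ₂⟩ = a⟨ρ₁,ρ₂⟩ for all a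
  -- (i.e. g lies in the normal core of ⟨ρ₁,ρ₂⟩)
  InVertexKernel : (Fin 3 → Carrier) → Carrier → Set (c ⊔ ℓ)
  InVertexKernel ρ g = ∀ a → InSub ρ V₁₂ (a ⁻¹ ∙ (g ∙ a))

  VertexFaithful : (Fin 3 → Carrier) → Set (c ⊔ ℓ)
  VertexFaithful ρ = ∀ g → InVertexKernel ρ g → g ≈ ε

  -- the number of vertices is n: a system of n pairwise distinct
  -- left-coset representatives of ⟨ρ₁,ρ₂⟩ covering Γ
  NumVertices : (Fin 3 → Carrier) → ℕ → Set (c ⊔ ℓ)
  NumVertices ρ n = Σ (Fin n → Carrier) (λ f →
      (∀ g → Σ (Fin n) (λ i → InSub ρ V₁₂ (f i ⁻¹ ∙ g)))
    × (∀ i j → InSub ρ V₁₂ (f i ⁻¹ ∙ f j) → i ≡ j))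

record RegularPolyhedron (c ℓ : Level) : Set (lsuc (c ⊔ ℓ)) where
  field
    Γ      : Group c ℓ
    ρ      : Fin 3 → Group.Carrier Γ
    isPoly : IsStringC Γ ρ
open RegularPolyhedron public

-- Γ(Q) → Γ(P) homomorphism sending distinguished generators to
-- distinguished generators (automatically onto, since ρ generates)
module _ {c₁ ℓ₁ c₂ ℓ₂ : Level} (G₁ : Group c₁ ℓ₁) (ρ₁ : Fin 3 → Group.Carrier G₁)
                               (G₂ : Group c₂ ℓ₂) (ρ₂ : Fin 3 → Group.Carrier G₂) where
  open MS.GroupMorphisms (Group.rawGroup G₁) (Group.rawGroup G₂)

  CoveringMap : (Group.Carrier G₁ → Group.Carrier G₂) → Set (c₁ ⊔ ℓ₁ ⊔ ℓ₂)
  CoveringMap f = IsGroupHomomorphism f × (∀ i → Group._≈_ G₂ (f (ρ₁ i)) (ρ₂ i))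

  Covers : Set (c₁ ⊔ ℓ₁ ⊔ c₂ ⊔ ℓ₂)
  Covers = Σ (Group.Carrier G₁ → Group.Carrier G₂) CoveringMap

  Isomorphic : Set (c₁ ⊔ ℓ₁ ⊔ c₂ ⊔ ℓ₂)
  Isomorphic = Σ (Group.Carrier G₁ → Group.Carrier G₂) (λ f →
    IsGroupIsomorphism f × (∀ i → Group._≈_ G₂ (f (ρ₁ i)) (ρ₂ i)))

  -- (G₂,ρ₂) is (isomorphic to) the vertex-faithful quotient of (G₁,ρ₁):
  -- a covering map whose kernel is exactly the normal core of ⟨ρ₁,ρ₂⟩
  VertexFaithfulQuotientIs : Set (c₁ ⊔ ℓ₁ ⊔ c₂ ⊔ ℓ₂)
  VertexFaithfulQuotientIs = Σ (Group.Carrier G₁ → Group.Carrier G₂) (λ f →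
    CoveringMap f ×
    (∀ g → (Group._≈_ G₂ (f g) (Group.ε G₂) → InVertexKernel G₁ ρ₁ g)
         × (InVertexKernel G₁ ρ₁ g → Group._≈_ G₂ (f g) (Group.ε G₂))))

-- The automorphism group of {4,4}_(s,0), realised faithfully (s ≥ 3) as
-- the group of affine maps of Z_s × Z_s (the faces of the map, face
-- centres at integer points) generated by
--   r₀ (x,y) = (-x , y)        (reflection in a line through a face centre)
--   r₁ (x,y) = (y , x)
--   r₂ (x,y) = (x , -1-y)      (reflection in a line through a vertex)
-- Elements are words in r₀,r₁,r₂, identified when they act equally.

-- negation mod n on Fin n (opposite i = n-1-i)
negF : ∀ {n} → Fin n → Fin n
negF zero    = zero
negF (suc i) = suc (opposite i)

negF-inv : ∀ {n} (i : Fin n) → negF (negF i) ≡ i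
negF-inv zero    = refl
negF-inv (suc i) = cong suc (opposite-involutive i)

Pt : ℕ → Set
Pt s = Fin s × Fin s

gen : ∀ {s} → Fin 3 → Pt s → Pt s
gen zero                (x , y) = (negF x , y)
gen (suc zero)          (x , y) = (y , x)
gen (suc (suc zero))    (x , y) = (x , opposite y)

gen-inv : ∀ {s} i (p : Pt s) → gen i (gen i p) ≡ p
gen-inv zero             (x , y) = cong (_, y) (negF-inv x)
gen-inv (suc zero)       (x , y) = refl
gen-inv (suc (suc zero)) (x , y) = cong (x ,_) (opposite-involutive y)

act : ∀ {s} → List (Fin 3) → Pt s → Pt s
act []      p = p
act (i ∷ w) p = gen i (act w p)

act-++ : ∀ {s} w v (p : Pt s) → act (w ++ v) p ≡ act w (act v p)
act-++ []      v p = refl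
act-++ (i ∷ w) v p = cong (gen i) (act-++ w v p)

act-rev : ∀ {s} w (p : Pt s) → act (reverse w) (act w p) ≡ p
act-rev []      p = refl
act-rev (i ∷ w) p = begin
    act (reverse (i ∷ w)) (gen i (act w p))
  ≡⟨ cong (λ z → act z (gen i (act w p))) (unfold-reverse i w) ⟩
    act (reverse w ++ [ i ]) (gen i (act w p))
  ≡⟨ act-++ (reverse w) [ i ] _ ⟩
    act (reverse w) (gen i (gen i (act w p)))
  ≡⟨ cong (act (reverse w)) (gen-inv i _) ⟩
    act (reverse w) (act w p)
  ≡⟨ act-rev w p ⟩
    p ∎
  where open Relation.Binary.PropositionalEquality.≡-Reasoning

act-rev′ : ∀ {s} w (p : Pt s) → act w (act (reverse w) p) ≡ p
act-rev′ w p = trans (cong (λ z → act z (act (reverse w) p)) (sym (reverse-involutive w)))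
                     (act-rev (reverse w) p)

module _ (s : ℕ) where
  private
    W = List (Fin 3)
    _≈W_ : W → W → Set
    w ≈W v = ∀ (p : Pt s) → act w p ≡ act v p

  toroidGroup : Group _ _
  toroidGroup = record
    { Carrier = W
    ; _≈_ = _≈W_
    ; _∙_ = _++_
    ; ε = []
    ; _⁻¹ = reverse
    ; isGroup = record
      { isMonoid = record
        { isSemigroup = record
          { isMagma = record
            { isEquivalence = record
              { refl = λ p → refl
              ; sym = λ e p → sym (e p)
              ; trans = λ e f p → trans (e p) (f p) }
            ; ∙-cong = λ {w} {w′} {v} {v′} e f p →
                trans (act-++ w v p)
                  (trans (e (act v p))
                    (trans (cong (act w′) (f p)) (sym (act-++ w′ v′ p)))) }
          ; assoc = λ x y z p → cong (λ t → act t p) (++-assoc x y z) }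
        ; identity = (λ w p → refl) , (λ w p → cong (λ t → act t p) (++-identityʳ w)) }
      ; inverse = (λ w p → trans (act-++ (reverse w) w p) (act-rev w p))
                , (λ w p → trans (act-++ w (reverse w) p) (act-rev′ w p))
      ; ⁻¹-cong = λ {w} {v} e p →
          trans (cong (act (reverse w)) (sym (act-rev′ v p)))
            (trans (cong (act (reverse w)) (sym (e (act (reverse v) p))))
                   (act-rev w (act (reverse v) p))) } }

toroidGens : Fin 3 → List (Fin 3)
toroidGens i = [ i ]

-- distinguished generators of the dual of the Petrial, ({4,4}_(s,0))^{πδ}:
-- Petrial: (r₀r₂, r₁, r₂);  dual reverses the order:  (r₂, r₁, r₀r₂)
petrieDualGens : Fin 3 → List (Fin 3)
petrieDualGens zero             = [ i2 ]
petrieDualGens (suc zero)       = [ i1 ]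
petrieDualGens (suc (suc zero)) = i0 ∷ i2 ∷ []

module _ {c ℓ : Level} (G : Group c ℓ) (ρ : Fin 3 → Group.Carrier G) where
  open Group G

  IsOfType : ℕ → ℕ → Set ℓ
  IsOfType p q = HasOrder G (ρ i0 ∙ ρ i1) p × HasOrder G (ρ i1 ∙ ρ i2) q

  SatisfiesRelation : ℕ → Set ℓ
  SatisfiesRelation k =
    ((ρ i0 ∙ pow G (ρ i1 ∙ ρ i2) k) ∙ ρ i0) ≈ (ρ i2 ∙ pow G (ρ i1 ∙ ρ i2) k)

module Submission where

-- Let F : Γ(Q) → Γ(P) be a covering whose kernel lies in the vertex stabiliser ⟨ρ₁,ρ₂⟩ of Q: in the
-- first part because the surjection induced by F on the n vertices of each side is a bijection, in
-- the second by definition of the vertex-faithful quotient. That stabiliser is dihedral, and F cannot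
-- kill a reflection σ₂ᵃρ₁, so ker F consists of rotations σ₂ᵃ. With x = σ₂^m the element
-- k = (ρ₂x)⁻¹ρ₀xρ₀ lies in ker F by the relation in Γ(P); hence ρ₀xρ₀ = ρ₂(xk) is a reflection of
-- the dihedral group, an involution, and so σ₂^(2m) = x² = 1 in Γ(Q). Since σ₂ has order 2m in Γ(P),
-- every rotation in ker F is trivial. For ({4,4}_(m,0))^{πδ} with m odd the relation and the order of
-- σ₂ are read off the action on the m² faces.

open import Defs
open import Level using (Level; _⊔_)
open import Algebra.Bundles using (Group)
import Algebra.Properties.Group as GroupProperties
import Algebra.Properties.Monoid as MonoidProperties
import Algebra.Properties.Monoid.Mult as MonoidMult
import Algebra.Morphism.Structures as MorphismStructures
import Relation.Binary.Reasoning.Setoid as SetoidReasoning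
open import Data.Nat using (ℕ; zero; suc; _+_; _*_; _∸_; _≤_; _<_; _%_; _/_; s≤s; >-nonZero)
open import Data.Nat.Properties
  using (_≟_; n≢0⇒n>0; 1+n≰n; +-identityʳ; +-comm; *-comm; ≤-antisym; m∸n≡0⇒m≤n; m∸[m∸n]≡n;
         m∸n≢0⇒n<m; 0≢1+n)
open import Data.Nat.DivMod
  using (m≡m%n+[m/n]*n; m%n<n; n%n≡0; m<n⇒m%n≡m; %-distribˡ-+; m%n%n≡m%n; [m+n]%n≡m%n; m*n%n≡0)
open import Data.Nat.Divisibility using (_∣_; divides; m%n≡0⇒n∣m; *-monoʳ-∣)
open import Data.Nat.Tactic.RingSolver using (solve-∀)
open import Data.Fin as Fin using (Fin; zero; suc; toℕ; opposite; punchOut)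
open import Data.Fin.Properties
  using (any?; punchOut-injective; injective⇒≤; toℕ-injective; toℕ<n; toℕ≤pred[n]; opposite-prop;
         opposite-involutive)
open import Data.Fin.Subset using (_∈_; ⊤)
open import Data.List using (List; []; _∷_; _++_; reverse; [_])
open import Data.List.Properties using (unfold-reverse)
open import Data.List.Relation.Unary.All using (All; []; _∷_)
open import Data.List.Relation.Unary.All.Properties using (++⁺; anti-mono)
open import Data.List.Relation.Unary.Any.Properties using (reverse⁻)
open import Data.Product as Product using (Σ; _×_; _,_; proj₁; proj₂; ∃-syntax)
open import Data.Sum as Sum using (_⊎_; inj₁; inj₂)
open import Function using (_∘_)
open import Relation.Nullary using (¬_; yes; no; contradiction)
open import Relation.Nullary.Decidable using (decidable-stable)
open import Relation.Binary.PropositionalEquality as ≡ using (_≡_; _≢_)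

Fin-injective⇒surjective : ∀ {n} (f : Fin n → Fin n) → (∀ {i j} → f i ≡ f j → i ≡ j) →
                           ∀ j → ∃[ i ] f i ≡ j
Fin-injective⇒surjective {zero}  f f-inj ()
Fin-injective⇒surjective {suc n} f f-inj j with any? (λ i → f i Fin.≟ j)
... | yes hit  = hit
... | no  miss = contradiction (injective⇒≤ avoid-injective) 1+n≰n
  where
    j≢f : ∀ i → j ≢ f i
    j≢f i j≡fi = miss (i , ≡.sym j≡fi)

    avoid : Fin (suc n) → Fin n
    avoid i = punchOut (j≢f i)

    avoid-injective : ∀ {i i′} → avoid i ≡ avoid i′ → i ≡ i′
    avoid-injective {i} {i′} eq = f-inj (punchOut-injective (j≢f i) (j≢f i′) eq)

even-or-odd : ∀ a → ∃[ b ] (a ≡ b * 2 ⊎ a ≡ suc (b * 2))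
even-or-odd zero    = 0 , inj₁ ≡.refl
even-or-odd (suc a) with even-or-odd a
... | b , inj₁ ≡.refl = b , inj₂ ≡.refl
... | b , inj₂ ≡.refl = suc b , inj₁ ≡.refl

module GroupLemmas {c ℓ : Level} (G : Group c ℓ) where
  open Group G
  open GroupProperties G public
  open MonoidProperties monoid public using (cancelˡ; cancelʳ; cancelᶜ; elimˡ; elimʳ)
  open MonoidMult monoid using (×-congʳ; ×-homo-+) renaming (_×_ to _×ᴹ_)
  open SetoidReasoning setoid

  _^_ : Carrier → ℕ → Carrier
  _^_ = pow G

  ^≡×ᴹ : ∀ g n → g ^ n ≡ n ×ᴹ g
  ^≡×ᴹ g zero    = ≡.refl
  ^≡×ᴹ g (suc n) = ≡.cong (g ∙_) (^≡×ᴹ g n)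

  ^-congˡ : ∀ {g h} n → g ≈ h → g ^ n ≈ h ^ n
  ^-congˡ {g} {h} n g≈h rewrite ^≡×ᴹ g n | ^≡×ᴹ h n = ×-congʳ n g≈h

  ^-homo-∙ : ∀ g m n → g ^ (m + n) ≈ g ^ m ∙ g ^ n
  ^-homo-∙ g m n rewrite ^≡×ᴹ g (m + n) | ^≡×ᴹ g m | ^≡×ᴹ g n = ×-homo-+ g m n

  ^-sucʳ : ∀ g n → g ^ suc n ≈ g ^ n ∙ g
  ^-sucʳ g zero    = trans (identityʳ g) (sym (identityˡ g))
  ^-sucʳ g (suc n) = trans (∙-congˡ (^-sucʳ g n)) (sym (assoc _ _ _))

  ^-multiple≈ε : ∀ g n k → g ^ n ≈ ε → g ^ (k * n) ≈ ε
  ^-multiple≈ε g n zero    gⁿ≈ε = refl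
  ^-multiple≈ε g n (suc k) gⁿ≈ε = begin
    g ^ (n + k * n)     ≈⟨ ^-homo-∙ g n (k * n) ⟩
    g ^ n ∙ g ^ (k * n) ≈⟨ ∙-cong gⁿ≈ε (^-multiple≈ε g n k gⁿ≈ε) ⟩
    ε ∙ ε               ≈⟨ identityˡ ε ⟩
    ε                   ∎

  ^-inverse : ∀ {g h} → g ∙ h ≈ ε → ∀ n → g ^ n ∙ h ^ n ≈ ε
  ^-inverse gh≈ε zero    = identityˡ ε
  ^-inverse {g} {h} gh≈ε (suc n) = begin
    (g ∙ g ^ n) ∙ h ^ suc n   ≈⟨ ∙-congˡ (^-sucʳ h n) ⟩
    (g ∙ g ^ n) ∙ (h ^ n ∙ h) ≈⟨ cancelᶜ (^-inverse gh≈ε n) g h ⟩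
    g ∙ h                     ≈⟨ gh≈ε ⟩
    ε                         ∎

  ^-conjugate : ∀ {x g h} → x ∙ g ≈ h ∙ x → ∀ n → x ∙ g ^ n ≈ h ^ n ∙ x
  ^-conjugate {x} xg≈hx zero    = trans (identityʳ x) (sym (identityˡ x))
  ^-conjugate {x} {g} {h} xg≈hx (suc n) = begin
    x ∙ (g ∙ g ^ n) ≈⟨ sym (assoc x g _) ⟩
    (x ∙ g) ∙ g ^ n ≈⟨ ∙-congʳ xg≈hx ⟩
    (h ∙ x) ∙ g ^ n ≈⟨ assoc h x _ ⟩
    h ∙ (x ∙ g ^ n) ≈⟨ ∙-congˡ (^-conjugate xg≈hx n) ⟩
    h ∙ (h ^ n ∙ x) ≈⟨ sym (assoc h _ x) ⟩
    h ^ suc n ∙ x   ∎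

  ^-mixed : ∀ {g h} → g ∙ h ≈ ε → ∀ a b → ∃[ k ] (g ^ a ∙ h ^ b ≈ g ^ k ⊎ g ^ a ∙ h ^ b ≈ h ^ k)
  ^-mixed gh≈ε zero    b       = b , inj₂ (identityˡ _)
  ^-mixed gh≈ε (suc a) zero    = suc a , inj₁ (identityʳ _)
  ^-mixed {g} {h} gh≈ε (suc a) (suc b) with ^-mixed gh≈ε a b
  ... | k , r = k , Sum.map (trans cancel) (trans cancel) r
    where
      cancel : g ^ suc a ∙ h ^ suc b ≈ g ^ a ∙ h ^ b
      cancel = trans (∙-congʳ (^-sucʳ g a)) (cancelᶜ gh≈ε (g ^ a) (h ^ b))

  conjugate-square≈ε : ∀ {r x} → r ∙ r ≈ ε → ((r ∙ x) ∙ r) ∙ ((r ∙ x) ∙ r) ≈ ε → x ∙ x ≈ ε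
  conjugate-square≈ε {r} {x} rr≈ε A²≈ε = begin
    x ∙ x             ≈⟨ sym (cancelˡ rr≈ε (x ∙ x)) ⟩
    r ∙ (r ∙ (x ∙ x)) ≈⟨ ∙-congˡ (inverseˡ-unique _ _ r[x²]r≈ε) ⟩
    r ∙ r ⁻¹          ≈⟨ inverseʳ r ⟩
    ε                 ∎
    where
      r[x²]r≈ε : (r ∙ (x ∙ x)) ∙ r ≈ ε
      r[x²]r≈ε = begin
        (r ∙ (x ∙ x)) ∙ r             ≈⟨ ∙-congʳ (sym (assoc r x x)) ⟩
        ((r ∙ x) ∙ x) ∙ r             ≈⟨ assoc (r ∙ x) x r ⟩
        (r ∙ x) ∙ (x ∙ r)             ≈⟨ sym (cancelᶜ rr≈ε (r ∙ x) (x ∙ r)) ⟩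
        ((r ∙ x) ∙ r) ∙ (r ∙ (x ∙ r)) ≈⟨ ∙-congˡ (sym (assoc r x r)) ⟩
        ((r ∙ x) ∙ r) ∙ ((r ∙ x) ∙ r) ≈⟨ A²≈ε ⟩
        ε                             ∎

  ^-of-involution : ∀ {g} → g ∙ g ≈ ε → ∀ n → g ^ n ≈ ε ⊎ g ^ n ≈ g
  ^-of-involution gg≈ε zero          = inj₁ refl
  ^-of-involution gg≈ε (suc zero)    = inj₂ (identityʳ _)
  ^-of-involution gg≈ε (suc (suc n)) =
    Sum.map (trans (cancelˡ gg≈ε _)) (trans (cancelˡ gg≈ε _)) (^-of-involution gg≈ε n)

  order-divides : ∀ {g n a} → HasOrder G g n → g ^ a ≈ ε → n ∣ a
  order-divides {g} {n} {a} (0<n , gⁿ≈ε , minimal) gᵃ≈ε = m%n≡0⇒n∣m a n a%n≡0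
    where
      instance _ = >-nonZero 0<n
      g^[a%n]≈ε : g ^ (a % n) ≈ ε
      g^[a%n]≈ε = begin
        g ^ (a % n)                   ≈⟨ sym (identityʳ _) ⟩
        g ^ (a % n) ∙ ε               ≈⟨ ∙-congˡ (sym (^-multiple≈ε g n (a / n) gⁿ≈ε)) ⟩
        g ^ (a % n) ∙ g ^ (a / n * n) ≈⟨ sym (^-homo-∙ g (a % n) (a / n * n)) ⟩
        g ^ (a % n + a / n * n)       ≡⟨ ≡.cong (g ^_) (≡.sym (m≡m%n+[m/n]*n a n)) ⟩
        g ^ a                         ≈⟨ gᵃ≈ε ⟩
        ε                             ∎
      a%n≡0 : a % n ≡ 0
      a%n≡0 = decidable-stable (a % n ≟ 0)
        (λ a%n≢0 → minimal (a % n) (n≢0⇒n>0 a%n≢0) (m%n<n a n) g^[a%n]≈ε)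

Involutions : ∀ {c ℓ} (G : Group c ℓ) → (Fin 3 → Group.Carrier G) → Set ℓ
Involutions G ρ = ∀ i → ρ i ∙ ρ i ≈ ε where open Group G

SameVertex : ∀ {c ℓ} (G : Group c ℓ) → (Fin 3 → Group.Carrier G) → (x y : Group.Carrier G) → Set ℓ
SameVertex G ρ x y = InSub G ρ (V₁₂ G) (x ⁻¹ ∙ y) where open Group G

module Words {c ℓ : Level} (G : Group c ℓ) (ρ : Fin 3 → Group.Carrier G) where
  open Group G
  open GroupLemmas G using (⁻¹-anti-homo-∙; ⁻¹-involutive; inverseˡ-unique; ε⁻¹≈ε; cancelᶜ)
  open SetoidReasoning setoid

  eval-++ : ∀ w v → eval G ρ (w ++ v) ≈ eval G ρ w ∙ eval G ρ v
  eval-++ []      v = sym (identityˡ _)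
  eval-++ (i ∷ w) v = trans (∙-congˡ (eval-++ w v)) (sym (assoc _ _ _))

  InSub-resp : ∀ {I g h} → g ≈ h → InSub G ρ I g → InSub G ρ I h
  InSub-resp g≈h (w , w∈I , w≈g) = w , w∈I , trans w≈g g≈h

  InSub-∙ : ∀ {I g h} → InSub G ρ I g → InSub G ρ I h → InSub G ρ I (g ∙ h)
  InSub-∙ (w , w∈I , w≈g) (v , v∈I , v≈h) =
    w ++ v , ++⁺ w∈I v∈I , trans (eval-++ w v) (∙-cong w≈g v≈h)


  SameVertex-trans : ∀ {x y z} → SameVertex G ρ x y → SameVertex G ρ y z → SameVertex G ρ x z
  SameVertex-trans {x} {y} {z} x~y y~z = InSub-resp (cancelᶜ (inverseʳ y) (x ⁻¹) z) (InSub-∙ x~y y~z)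

  SameVertex-respʳ : ∀ {x y y′} → y ≈ y′ → SameVertex G ρ x y → SameVertex G ρ x y′
  SameVertex-respʳ y≈y′ = InSub-resp (∙-congˡ y≈y′)


  vertexKernel⊆vertexStabiliser : ∀ {g} → InVertexKernel G ρ g → InSub G ρ (V₁₂ G) g
  vertexKernel⊆vertexStabiliser {g} g∈kernel =
    InSub-resp (trans (∙-cong ε⁻¹≈ε (identityʳ g)) (identityˡ g)) (g∈kernel ε)

  module _ (involution : Involutions G ρ) where

    ρ⁻¹≈ρ : ∀ i → ρ i ⁻¹ ≈ ρ i
    ρ⁻¹≈ρ i = sym (inverseˡ-unique _ _ (involution i))

    eval-reverse : ∀ w → eval G ρ (reverse w) ≈ eval G ρ w ⁻¹
    eval-reverse []      = sym ε⁻¹≈ε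
    eval-reverse (i ∷ w) = begin
      eval G ρ (reverse (i ∷ w))     ≡⟨ ≡.cong (eval G ρ) (unfold-reverse i w) ⟩
      eval G ρ (reverse w ++ [ i ])  ≈⟨ eval-++ (reverse w) [ i ] ⟩
      eval G ρ (reverse w) ∙ (ρ i ∙ ε) ≈⟨ ∙-cong (eval-reverse w) (trans (identityʳ _) (sym (ρ⁻¹≈ρ i))) ⟩
      eval G ρ w ⁻¹ ∙ ρ i ⁻¹         ≈⟨ sym (⁻¹-anti-homo-∙ _ _) ⟩
      (ρ i ∙ eval G ρ w) ⁻¹          ∎

    InSub-⁻¹ : ∀ {I g} → InSub G ρ I g → InSub G ρ I (g ⁻¹)
    InSub-⁻¹ (w , w∈I , w≈g) =
      reverse w , anti-mono reverse⁻ w∈I , trans (eval-reverse w) (⁻¹-cong w≈g)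

    SameVertex-sym : ∀ {x y} → SameVertex G ρ x y → SameVertex G ρ y x
    SameVertex-sym {x} {y} x~y = InSub-resp (begin
      (x ⁻¹ ∙ y) ⁻¹      ≈⟨ ⁻¹-anti-homo-∙ _ _ ⟩
      y ⁻¹ ∙ x ⁻¹ ⁻¹     ≈⟨ ∙-congˡ (⁻¹-involutive x) ⟩
      y ⁻¹ ∙ x           ∎) (InSub-⁻¹ x~y)

module Dihedral {c ℓ : Level} (G : Group c ℓ) (ρ : Fin 3 → Group.Carrier G)
                (involution : Involutions G ρ) where
  open Group G
  open GroupLemmas G
  open Words G ρ using (ρ⁻¹≈ρ)
  open SetoidReasoning setoid

  σ τ : Carrier
  σ = ρ i1 ∙ ρ i2
  τ = ρ i2 ∙ ρ i1

  σ∙τ≈ε : σ ∙ τ ≈ ε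
  σ∙τ≈ε = trans (cancelᶜ (involution i2) (ρ i1) (ρ i1)) (involution i1)

  τ∙σ≈ε : τ ∙ σ ≈ ε
  τ∙σ≈ε = trans (cancelᶜ (involution i1) (ρ i2) (ρ i2)) (involution i2)

  σ^a≈ε⇒τ^a≈ε : ∀ a → σ ^ a ≈ ε → τ ^ a ≈ ε
  σ^a≈ε⇒τ^a≈ε a σᵃ≈ε = trans (sym (elimˡ σᵃ≈ε (τ ^ a))) (^-inverse σ∙τ≈ε a)

  τ^a≈ε⇒σ^a≈ε : ∀ a → τ ^ a ≈ ε → σ ^ a ≈ ε
  τ^a≈ε⇒σ^a≈ε a τᵃ≈ε = trans (sym (elimʳ τᵃ≈ε (σ ^ a))) (^-inverse σ∙τ≈ε a)

  ρ₁∙σ≈τ∙ρ₁ : ρ i1 ∙ σ ≈ τ ∙ ρ i1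
  ρ₁∙σ≈τ∙ρ₁ = trans (cancelˡ (involution i1) (ρ i2)) (sym (cancelʳ (involution i1) (ρ i2)))

  ρ₂∙τ≈σ∙ρ₂ : ρ i2 ∙ τ ≈ σ ∙ ρ i2
  ρ₂∙τ≈σ∙ρ₂ = trans (cancelˡ (involution i2) (ρ i1)) (sym (cancelʳ (involution i2) (ρ i1)))

  -- τ = σ⁻¹, so the rotations σᵃ and τᵃ are all integer powers of σ.
  Rotation : Carrier → Set ℓ
  Rotation y = ∃[ a ] (y ≈ σ ^ a ⊎ y ≈ τ ^ a)

  Reflection : Carrier → Set (c ⊔ ℓ)
  Reflection y = ∃[ z ] (Rotation z × y ≈ z ∙ ρ i1)

  Rotation-resp : ∀ {y y′} → y ≈ y′ → Rotation y → Rotation y′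
  Rotation-resp y≈y′ (a , r) = a , Sum.map (trans (sym y≈y′)) (trans (sym y≈y′)) r

  Reflection-resp : ∀ {y y′} → y ≈ y′ → Reflection y → Reflection y′
  Reflection-resp y≈y′ (z , rot , y≈zρ₁) = z , rot , trans (sym y≈y′) y≈zρ₁

  Rotation-∙ : ∀ {x y} → Rotation x → Rotation y → Rotation (x ∙ y)
  Rotation-∙ (a , inj₁ x≈) (b , inj₁ y≈) = a + b , inj₁ (trans (∙-cong x≈ y≈) (sym (^-homo-∙ σ a b)))
  Rotation-∙ (a , inj₂ x≈) (b , inj₂ y≈) = a + b , inj₂ (trans (∙-cong x≈ y≈) (sym (^-homo-∙ τ a b)))
  Rotation-∙ (a , inj₁ x≈) (b , inj₂ y≈) = Rotation-resp (sym (∙-cong x≈ y≈)) (^-mixed σ∙τ≈ε a b)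
  Rotation-∙ (a , inj₂ x≈) (b , inj₁ y≈) =
    Rotation-resp (sym (∙-cong x≈ y≈)) (Product.map₂ Sum.swap (^-mixed τ∙σ≈ε a b))

  ρ₁∙Rotation : ∀ {y} → Rotation y → Reflection (ρ i1 ∙ y)
  ρ₁∙Rotation (a , inj₁ y≈) = τ ^ a , (a , inj₂ refl) , trans (∙-congˡ y≈) (^-conjugate ρ₁∙σ≈τ∙ρ₁ a)
  ρ₁∙Rotation (a , inj₂ y≈) = σ ^ a , (a , inj₁ refl) , trans (∙-congˡ y≈) (^-conjugate (sym (assoc _ _ _)) a)

  ρ₁∙Reflection : ∀ {y} → Reflection y → Rotation (ρ i1 ∙ y)
  ρ₁∙Reflection {y} (z , rot , y≈zρ₁) with ρ₁∙Rotation rot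
  ... | z′ , rot′ , ρ₁z≈z′ρ₁ = Rotation-resp (sym (begin
    ρ i1 ∙ y                ≈⟨ ∙-congˡ y≈zρ₁ ⟩
    ρ i1 ∙ (z ∙ ρ i1)       ≈⟨ sym (assoc _ _ _) ⟩
    (ρ i1 ∙ z) ∙ ρ i1       ≈⟨ ∙-congʳ ρ₁z≈z′ρ₁ ⟩
    (z′ ∙ ρ i1) ∙ ρ i1      ≈⟨ cancelʳ (involution i1) z′ ⟩
    z′                      ∎)) rot′

  σ∙Rotation : ∀ {y} → Rotation y → Rotation (σ ∙ y)
  σ∙Rotation = Rotation-∙ (1 , inj₁ (sym (identityʳ σ)))

  σ∙Reflection : ∀ {y} → Reflection y → Reflection (σ ∙ y)
  σ∙Reflection (z , rot , y≈zρ₁) = σ ∙ z , σ∙Rotation rot , trans (∙-congˡ y≈zρ₁) (sym (assoc _ _ _))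

  DihedralForm : Carrier → Set (c ⊔ ℓ)
  DihedralForm y = Rotation y ⊎ Reflection y

  vertexStabiliser-dihedral : ∀ {y} → InSub G ρ (V₁₂ G) y → DihedralForm y
  vertexStabiliser-dihedral (w , w∈V , w≈y) = DihedralForm-resp w≈y (word-dihedral w w∈V)
    where
      DihedralForm-resp : ∀ {y y′} → y ≈ y′ → DihedralForm y → DihedralForm y′
      DihedralForm-resp y≈y′ = Sum.map (Rotation-resp y≈y′) (Reflection-resp y≈y′)

      ρ₁∙ : ∀ {y} → DihedralForm y → DihedralForm (ρ i1 ∙ y)
      ρ₁∙ = Sum.swap ∘ Sum.map ρ₁∙Rotation ρ₁∙Reflection

      ρ₁∙σ∙≈ρ₂∙ : ∀ y → ρ i1 ∙ (σ ∙ y) ≈ ρ i2 ∙ y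
      ρ₁∙σ∙≈ρ₂∙ y = trans (∙-congˡ (assoc _ _ _)) (cancelˡ (involution i1) (ρ i2 ∙ y))

      word-dihedral : ∀ w → All (_∈ V₁₂ G) w → DihedralForm (eval G ρ w)
      word-dihedral []                   []          = inj₁ (0 , inj₁ refl)
      word-dihedral (zero ∷ w)           (() ∷ _)
      word-dihedral (suc zero ∷ w)       (_ ∷ w∈V)   = ρ₁∙ (word-dihedral w w∈V)
      word-dihedral (suc (suc zero) ∷ w) (_ ∷ w∈V)   =
        DihedralForm-resp (ρ₁∙σ∙≈ρ₂∙ _) (ρ₁∙ (Sum.map σ∙Rotation σ∙Reflection (word-dihedral w w∈V)))

  ρ₂∙Rotation-involution : ∀ {y} → Rotation y → (ρ i2 ∙ y) ∙ (ρ i2 ∙ y) ≈ ε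
  ρ₂∙Rotation-involution {y} (a , inj₁ y≈) = begin
    (ρ i2 ∙ y) ∙ (ρ i2 ∙ y)         ≈⟨ ∙-cong (∙-congˡ y≈) (∙-congˡ y≈) ⟩
    (ρ i2 ∙ σ ^ a) ∙ (ρ i2 ∙ σ ^ a) ≈⟨ ∙-congʳ (^-conjugate (sym (assoc _ _ _)) a) ⟩
    (τ ^ a ∙ ρ i2) ∙ (ρ i2 ∙ σ ^ a) ≈⟨ cancelᶜ (involution i2) _ _ ⟩
    τ ^ a ∙ σ ^ a                   ≈⟨ ^-inverse τ∙σ≈ε a ⟩
    ε                               ∎
  ρ₂∙Rotation-involution {y} (a , inj₂ y≈) = begin
    (ρ i2 ∙ y) ∙ (ρ i2 ∙ y)         ≈⟨ ∙-cong (∙-congˡ y≈) (∙-congˡ y≈) ⟩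
    (ρ i2 ∙ τ ^ a) ∙ (ρ i2 ∙ τ ^ a) ≈⟨ ∙-congʳ (^-conjugate ρ₂∙τ≈σ∙ρ₂ a) ⟩
    (σ ^ a ∙ ρ i2) ∙ (ρ i2 ∙ τ ^ a) ≈⟨ cancelᶜ (involution i2) _ _ ⟩
    σ ^ a ∙ τ ^ a                   ≈⟨ ^-inverse σ∙τ≈ε a ⟩
    ε                               ∎

  σ^a≈ρ₁⇒degenerate : ∀ a → σ ^ a ≈ ρ i1 → ρ i1 ≈ ε ⊎ ρ i2 ≈ ε
  σ^a≈ρ₁⇒degenerate a σᵃ≈ρ₁ = Sum.map (trans (sym σᵃ≈ρ₁)) σᵃ≈σ⇒ρ₂≈ε (^-of-involution σ∙σ≈ε a)
    where
      ρ₁∙σ≈σ∙ρ₁ : ρ i1 ∙ σ ≈ σ ∙ ρ i1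
      ρ₁∙σ≈σ∙ρ₁ = begin
        ρ i1 ∙ σ   ≈⟨ ∙-congʳ (sym σᵃ≈ρ₁) ⟩
        σ ^ a ∙ σ  ≈⟨ sym (^-sucʳ σ a) ⟩
        σ ∙ σ ^ a  ≈⟨ ∙-congˡ σᵃ≈ρ₁ ⟩
        σ ∙ ρ i1   ∎

      σ∙σ≈ε : σ ∙ σ ≈ ε
      σ∙σ≈ε = trans (∙-congˡ (begin
        σ                  ≈⟨ sym (cancelʳ (involution i1) σ) ⟩
        (σ ∙ ρ i1) ∙ ρ i1  ≈⟨ ∙-congʳ (sym ρ₁∙σ≈σ∙ρ₁) ⟩
        (ρ i1 ∙ σ) ∙ ρ i1  ≈⟨ ∙-congʳ ρ₁∙σ≈τ∙ρ₁ ⟩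
        (τ ∙ ρ i1) ∙ ρ i1  ≈⟨ cancelʳ (involution i1) τ ⟩
        τ                  ∎)) σ∙τ≈ε

      σᵃ≈σ⇒ρ₂≈ε : σ ^ a ≈ σ → ρ i2 ≈ ε
      σᵃ≈σ⇒ρ₂≈ε σᵃ≈σ = begin
        ρ i2                  ≈⟨ sym (cancelˡ (involution i1) (ρ i2)) ⟩
        ρ i1 ∙ σ              ≈⟨ ∙-congˡ (trans (sym σᵃ≈σ) σᵃ≈ρ₁) ⟩
        ρ i1 ∙ ρ i1           ≈⟨ involution i1 ⟩
        ε                     ∎

  module _ (ρ₁≉ε : ¬ ρ i1 ≈ ε) (ρ₂≉ε : ¬ ρ i2 ≈ ε) where

    Rotation≉ρ₁ : ∀ {z} → Rotation z → ¬ z ≈ ρ i1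
    Rotation≉ρ₁ {z} (a , z≈) z≈ρ₁ = Sum.[ ρ₁≉ε , ρ₂≉ε ]′ (σ^a≈ρ₁⇒degenerate a (σᵃ≈ρ₁ z≈))
      where
        σᵃ≈ρ₁ : z ≈ σ ^ a ⊎ z ≈ τ ^ a → σ ^ a ≈ ρ i1
        σᵃ≈ρ₁ (inj₁ z≈σᵃ) = trans (sym z≈σᵃ) z≈ρ₁
        σᵃ≈ρ₁ (inj₂ z≈τᵃ) = begin
          σ ^ a          ≈⟨ inverseˡ-unique _ _ (^-inverse σ∙τ≈ε a) ⟩
          τ ^ a ⁻¹       ≈⟨ ⁻¹-cong (trans (sym z≈τᵃ) z≈ρ₁) ⟩
          ρ i1 ⁻¹        ≈⟨ ρ⁻¹≈ρ involution i1 ⟩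
          ρ i1           ∎

    Reflection≉ε : ∀ {y} → Reflection y → ¬ y ≈ ε
    Reflection≉ε (z , rot , y≈zρ₁) y≈ε = Rotation≉ρ₁ rot (begin
      z            ≈⟨ inverseˡ-unique _ _ (trans (sym y≈zρ₁) y≈ε) ⟩
      ρ i1 ⁻¹      ≈⟨ ρ⁻¹≈ρ involution i1 ⟩
      ρ i1         ∎)

module Covering {cQ ℓQ cP ℓP : Level} {ΓQ : Group cQ ℓQ} {ΓP : Group cP ℓP}
                {ρQ : Fin 3 → Group.Carrier ΓQ} {ρP : Fin 3 → Group.Carrier ΓP}
                (F : Group.Carrier ΓQ → Group.Carrier ΓP) (covering : CoveringMap ΓQ ρQ ΓP ρP F)
                (involutionQ : Involutions ΓQ ρQ) where
  private
    module Q = Group ΓQ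
    module P = Group ΓP
    module QL = GroupLemmas ΓQ
    module PL = GroupLemmas ΓP
    module QW = Words ΓQ ρQ
    module PW = Words ΓP ρP
  open MorphismStructures.GroupMorphisms Q.rawGroup P.rawGroup using (module IsGroupHomomorphism; IsGroupIsomorphism)
  open IsGroupHomomorphism (proj₁ covering)
    renaming (⟦⟧-cong to F-cong; homo to F-∙; ε-homo to F-ε; ⁻¹-homo to F-⁻¹)

  F-ρ : ∀ i → F (ρQ i) P.≈ ρP i
  F-ρ = proj₂ covering

  F-^ : ∀ g a → F (g QL.^ a) P.≈ F g PL.^ a
  F-^ g zero    = F-ε
  F-^ g (suc a) = P.trans (F-∙ _ _) (P.∙-congˡ (F-^ g a))

  F-eval : ∀ w → F (eval ΓQ ρQ w) P.≈ eval ΓP ρP w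
  F-eval []      = F-ε
  F-eval (i ∷ w) = P.trans (F-∙ _ _) (P.∙-cong (F-ρ i) (F-eval w))

  F-InSub : ∀ {I g} → InSub ΓQ ρQ I g → InSub ΓP ρP I (F g)
  F-InSub (w , w∈I , w≈g) = w , w∈I , P.trans (P.sym (F-eval w)) (F-cong w≈g)

  F-SameVertex : ∀ {x y} → SameVertex ΓQ ρQ x y → SameVertex ΓP ρP (F x) (F y)
  F-SameVertex x~y = PW.InSub-resp (P.trans (F-∙ _ _) (P.∙-congʳ (F-⁻¹ _))) (F-InSub x~y)

  involutionP : Involutions ΓP ρP
  involutionP i = begin
    ρP i P.∙ ρP i         ≈⟨ P.sym (P.∙-cong (F-ρ i) (F-ρ i)) ⟩
    F (ρQ i) P.∙ F (ρQ i) ≈⟨ P.sym (F-∙ _ _) ⟩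
    F (ρQ i Q.∙ ρQ i)     ≈⟨ F-cong (involutionQ i) ⟩
    F Q.ε                 ≈⟨ F-ε ⟩
    P.ε                   ∎
    where open SetoidReasoning P.setoid

  F-surjective : (∀ y → InSub ΓP ρP ⊤ y) → ∀ y → ∃[ x ] F x P.≈ y
  F-surjective generated y with generated y
  ... | w , _ , w≈y = eval ΓQ ρQ w , P.trans (F-eval w) w≈y

  kernel⊆vertexStabiliser : ∀ {n} → (∀ y → InSub ΓP ρP ⊤ y) →
    NumVertices ΓQ ρQ n → NumVertices ΓP ρP n →
    ∀ g → F g P.≈ P.ε → InSub ΓQ ρQ (V₁₂ ΓQ) g
  kernel⊆vertexStabiliser {n} generated (fQ , coverQ , _) (fP , _ , distinctP) g Fg≈ε =
    same-vertex (vertex-in-kernel Fg≈ε) (vertex-in-kernel F-ε)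
    where
      lift : Fin n → Q.Carrier
      lift j = proj₁ (F-surjective generated (fP j))

      F-lift : ∀ j → F (lift j) P.≈ fP j
      F-lift j = proj₂ (F-surjective generated (fP j))

      ψ : Fin n → Fin n
      ψ j = proj₁ (coverQ (lift j))

      ψ~lift : ∀ j → SameVertex ΓQ ρQ (fQ (ψ j)) (lift j)
      ψ~lift j = proj₂ (coverQ (lift j))

      vertex-image : ∀ j {x} → SameVertex ΓQ ρQ (fQ (ψ j)) x → SameVertex ΓP ρP (fP j) (F x)
      vertex-image j ψj~x = PW.SameVertex-trans
        (PW.SameVertex-sym involutionP (PW.SameVertex-respʳ (F-lift j) (F-SameVertex (ψ~lift j))))
        (F-SameVertex ψj~x)

      ψ-injective : ∀ {j j′} → ψ j ≡ ψ j′ → j ≡ j′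
      ψ-injective {j} {j′} ψj≡ψj′ = distinctP j j′ (PW.SameVertex-respʳ (F-lift j′)
        (vertex-image j (≡.subst (λ i → SameVertex ΓQ ρQ (fQ i) (lift j′)) (≡.sym ψj≡ψj′) (ψ~lift j′))))

      KernelVertex : Q.Carrier → Set (ℓQ ⊔ ℓP)
      KernelVertex x = ∃[ j ] SameVertex ΓQ ρQ (fQ (ψ j)) x × SameVertex ΓP ρP (fP j) P.ε

      vertex-in-kernel : ∀ {x} → F x P.≈ P.ε → KernelVertex x
      vertex-in-kernel {x} Fx≈ε with coverQ x
      ... | i , i~x with Fin-injective⇒surjective ψ ψ-injective i
      ... | j , ≡.refl = j , i~x , PW.SameVertex-respʳ Fx≈ε (vertex-image j i~x)

      same-vertex : KernelVertex g → KernelVertex Q.ε → InSub ΓQ ρQ (V₁₂ ΓQ) g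
      same-vertex (j , ψj~g , j~ε) (j₀ , ψj₀~ε , j₀~ε)
        with distinctP j j₀ (PW.SameVertex-trans j~ε (PW.SameVertex-sym involutionP j₀~ε))
      ... | ≡.refl = QW.InSub-resp (QL.elimˡ QL.ε⁻¹≈ε g)
                       (QW.SameVertex-trans (QW.SameVertex-sym involutionQ ψj₀~ε) ψj~g)

  trivial-kernel⇒Isomorphic : (∀ y → InSub ΓP ρP ⊤ y) → (∀ g → F g P.≈ P.ε → g Q.≈ Q.ε) →
                              Isomorphic ΓQ ρQ ΓP ρP
  trivial-kernel⇒Isomorphic generated kernel-trivial = F , isomorphism , F-ρ
    where
      isomorphism : IsGroupIsomorphism F
      isomorphism = record
        { isGroupMonomorphism = record
          { isGroupHomomorphism = proj₁ covering
          ; injective = λ {x} {y} Fx≈Fy → QL.x∙y⁻¹≈ε⇒x≈y x y (kernel-trivial _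
              (P.trans (F-∙ x _) (P.trans (P.∙-cong Fx≈Fy (F-⁻¹ y)) (P.inverseʳ _))))
          }
        ; surjective = λ y → proj₁ (F-surjective generated y) ,
                             λ z≈x → P.trans (F-cong z≈x) (proj₂ (F-surjective generated y))
        }

  private
    module DQ = Dihedral ΓQ ρQ involutionQ
    module DP = Dihedral ΓP ρP involutionP

  F-σ^ : ∀ a → F (DQ.σ QL.^ a) P.≈ DP.σ PL.^ a
  F-σ^ a = P.trans (F-^ DQ.σ a) (PL.^-congˡ a (P.trans (F-∙ _ _) (P.∙-cong (F-ρ i1) (F-ρ i2))))

  F-τ^ : ∀ a → F (DQ.τ QL.^ a) P.≈ DP.τ PL.^ a
  F-τ^ a = P.trans (F-^ DQ.τ a) (PL.^-congˡ a (P.trans (F-∙ _ _) (P.∙-cong (F-ρ i2) (F-ρ i1))))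

  F-Rotation : ∀ {y} → DQ.Rotation y → DP.Rotation (F y)
  F-Rotation (a , inj₁ y≈) = a , inj₁ (P.trans (F-cong y≈) (F-σ^ a))
  F-Rotation (a , inj₂ y≈) = a , inj₂ (P.trans (F-cong y≈) (F-τ^ a))

  F-Reflection : ∀ {y} → DQ.Reflection y → DP.Reflection (F y)
  F-Reflection (z , rot , y≈zρ₁) =
    F z , F-Rotation rot , P.trans (F-cong y≈zρ₁) (P.trans (F-∙ z _) (P.∙-congˡ (F-ρ i1)))

  module _ (m : ℕ) (order : ∀ a → DP.σ PL.^ a P.≈ P.ε → 2 * m ∣ a)
           (ρ₁≉ε : ¬ ρP i1 P.≈ P.ε) (ρ₂≉ε : ¬ ρP i2 P.≈ P.ε) (relation : SatisfiesRelation ΓP ρP m)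
           (kernel⊆V : ∀ g → F g P.≈ P.ε → InSub ΓQ ρQ (V₁₂ ΓQ) g) where

    kernel-Rotation : ∀ {g} → F g P.≈ P.ε → DQ.Rotation g
    kernel-Rotation {g} Fg≈ε with DQ.vertexStabiliser-dihedral (kernel⊆V g Fg≈ε)
    ... | inj₁ rot  = rot
    ... | inj₂ ref = contradiction Fg≈ε (DP.Reflection≉ε ρ₁≉ε ρ₂≉ε (F-Reflection ref))

    private
      x A k : Q.Carrier
      x = DQ.σ QL.^ m
      A = (ρQ i0 Q.∙ x) Q.∙ ρQ i0
      k = (ρQ i2 Q.∙ x) Q.⁻¹ Q.∙ A

    Fk≈ε : F k P.≈ P.ε
    Fk≈ε = begin
      F k                                                      ≈⟨ F-∙ _ _ ⟩
      F ((ρQ i2 Q.∙ x) Q.⁻¹) P.∙ F A                           ≈⟨ P.∙-cong (F-⁻¹ _) (F-∙ _ _) ⟩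
      F (ρQ i2 Q.∙ x) P.⁻¹ P.∙ (F (ρQ i0 Q.∙ x) P.∙ F (ρQ i0)) ≈⟨ P.∙-cong (P.⁻¹-cong (F-∙ _ _)) (P.∙-cong (F-∙ _ _) (F-ρ i0)) ⟩
      (F (ρQ i2) P.∙ F x) P.⁻¹ P.∙ ((F (ρQ i0) P.∙ F x) P.∙ ρP i0)
        ≈⟨ P.∙-cong (P.⁻¹-cong (P.∙-cong (F-ρ i2) (F-σ^ m))) (P.∙-congʳ (P.∙-cong (F-ρ i0) (F-σ^ m))) ⟩
      (ρP i2 P.∙ DP.σ PL.^ m) P.⁻¹ P.∙ ((ρP i0 P.∙ DP.σ PL.^ m) P.∙ ρP i0) ≈⟨ P.∙-congˡ relation ⟩
      (ρP i2 P.∙ DP.σ PL.^ m) P.⁻¹ P.∙ (ρP i2 P.∙ DP.σ PL.^ m)  ≈⟨ P.inverseˡ _ ⟩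
      P.ε                                                      ∎
      where open SetoidReasoning P.setoid

    σQ^2m≈ε : DQ.σ QL.^ (2 * m) Q.≈ Q.ε
    σQ^2m≈ε = begin
      DQ.σ QL.^ (m + (m + 0))  ≡⟨ ≡.cong (λ n → DQ.σ QL.^ (m + n)) (+-identityʳ m) ⟩
      DQ.σ QL.^ (m + m)        ≈⟨ QL.^-homo-∙ DQ.σ m m ⟩
      x Q.∙ x                  ≈⟨ QL.conjugate-square≈ε (involutionQ i0) A²≈ε ⟩
      Q.ε                      ∎
      where
        open SetoidReasoning Q.setoid

        A≈ρ₂xk : A Q.≈ ρQ i2 Q.∙ (x Q.∙ k)
        A≈ρ₂xk = Q.sym (Q.trans (Q.sym (Q.assoc _ _ _)) (QL.cancelˡ (Q.inverseʳ _) A))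

        A²≈ε : A Q.∙ A Q.≈ Q.ε
        A²≈ε = Q.trans (Q.∙-cong A≈ρ₂xk A≈ρ₂xk)
          (DQ.ρ₂∙Rotation-involution (DQ.Rotation-∙ (m , inj₁ Q.refl) (kernel-Rotation Fk≈ε)))

    σQ^a≈ε : ∀ a → DP.σ PL.^ a P.≈ P.ε → DQ.σ QL.^ a Q.≈ Q.ε
    σQ^a≈ε a σPᵃ≈ε with order a σPᵃ≈ε
    ... | divides k ≡.refl = QL.^-multiple≈ε DQ.σ (2 * m) k σQ^2m≈ε

    kernel-trivial : ∀ g → F g P.≈ P.ε → g Q.≈ Q.ε
    kernel-trivial g Fg≈ε with kernel-Rotation Fg≈ε
    ... | a , inj₁ g≈σᵃ = Q.trans g≈σᵃ (σQ^a≈ε a (P.trans (P.sym (F-σ^ a)) (P.trans (F-cong (Q.sym g≈σᵃ)) Fg≈ε)))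
    ... | a , inj₂ g≈τᵃ = Q.trans g≈τᵃ (DQ.σ^a≈ε⇒τ^a≈ε a (σQ^a≈ε a
          (DP.τ^a≈ε⇒σ^a≈ε a (P.trans (P.sym (F-τ^ a)) (P.trans (F-cong (Q.sym g≈τᵃ)) Fg≈ε)))))

module Cyclic (k : ℕ) where
  open import Function.Endo.Propositional (Fin (suc k)) using (_^_; ^-homo) public

  -- inc y = y + 1 and dec x = x − 1, modulo k + 1.
  inc dec : Fin (suc k) → Fin (suc k)
  inc y = negF (opposite y)
  dec x = opposite (negF x)

  dec∘inc : ∀ y → dec (inc y) ≡ y
  dec∘inc y = ≡.trans (≡.cong opposite (negF-inv (opposite y))) (opposite-involutive y)

  ^-suc : ∀ f a y → (f ^ suc a) y ≡ (f ^ a) (f y)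
  ^-suc f a y = ≡.trans (≡.cong (λ b → (f ^ b) y) (+-comm 1 a)) (≡.cong-app (^-homo f a 1) y)

  dec^∘inc^ : ∀ a y → (dec ^ a) ((inc ^ a) y) ≡ y
  dec^∘inc^ zero    y = ≡.refl
  dec^∘inc^ (suc a) y = begin
    (dec ^ suc a) (inc ((inc ^ a) y))   ≡⟨ ^-suc dec a _ ⟩
    (dec ^ a) (dec (inc ((inc ^ a) y))) ≡⟨ ≡.cong (dec ^ a) (dec∘inc _) ⟩
    (dec ^ a) ((inc ^ a) y)             ≡⟨ dec^∘inc^ a y ⟩
    y                                   ∎
    where open ≡.≡-Reasoning

  opposite∘inc^∘opposite : ∀ a y → opposite ((inc ^ a) (opposite y)) ≡ (dec ^ a) y
  opposite∘inc^∘opposite zero    y = opposite-involutive y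
  opposite∘inc^∘opposite (suc a) y = ≡.cong dec (opposite∘inc^∘opposite a y)

  toℕ-inc : ∀ y → toℕ (inc y) ≡ suc (toℕ y) % suc k
  toℕ-inc y with opposite y in opposite-y
  ... | zero  = ≡.sym (≡.trans (≡.cong (λ t → suc t % suc k) y≡k) (n%n≡0 (suc k)))
    where
      y≡k : toℕ y ≡ k
      y≡k = ≤-antisym (toℕ≤pred[n] y)
        (m∸n≡0⇒m≤n (≡.trans (≡.sym (opposite-prop y)) (≡.cong toℕ opposite-y)))
  ... | suc j = begin
    suc (toℕ (opposite j))     ≡⟨ ≡.cong suc (opposite-prop j) ⟩
    suc (k ∸ suc (toℕ j))      ≡⟨ ≡.cong (λ t → suc (k ∸ t)) 1+j≡k∸y ⟩
    suc (k ∸ (k ∸ toℕ y))      ≡⟨ ≡.cong suc (m∸[m∸n]≡n (toℕ≤pred[n] y)) ⟩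
    suc (toℕ y)                ≡⟨ ≡.sym (m<n⇒m%n≡m (s≤s y<k)) ⟩
    suc (toℕ y) % suc k        ∎
    where
      open ≡.≡-Reasoning
      1+j≡k∸y : suc (toℕ j) ≡ k ∸ toℕ y
      1+j≡k∸y = ≡.trans (≡.sym (≡.cong toℕ opposite-y)) (opposite-prop y)
      y<k : toℕ y < k
      y<k = m∸n≢0⇒n<m (λ k∸y≡0 → 0≢1+n (≡.trans (≡.sym k∸y≡0) (≡.sym 1+j≡k∸y)))

  toℕ-inc^ : ∀ a y → toℕ ((inc ^ a) y) ≡ (a + toℕ y) % suc k
  toℕ-inc^ zero    y = ≡.sym (m<n⇒m%n≡m (toℕ<n y))
  toℕ-inc^ (suc a) y = begin
    toℕ (inc ((inc ^ a) y))              ≡⟨ toℕ-inc _ ⟩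
    suc (toℕ ((inc ^ a) y)) % suc k      ≡⟨ ≡.cong (λ t → suc t % suc k) (toℕ-inc^ a y) ⟩
    suc ((a + toℕ y) % suc k) % suc k    ≡⟨ %-distribˡ-+ 1 ((a + toℕ y) % suc k) (suc k) ⟩
    (1 % suc k + (a + toℕ y) % suc k % suc k) % suc k
      ≡⟨ ≡.cong (λ t → (1 % suc k + t) % suc k) (m%n%n≡m%n (a + toℕ y) (suc k)) ⟩
    (1 % suc k + (a + toℕ y) % suc k) % suc k ≡⟨ ≡.sym (%-distribˡ-+ 1 (a + toℕ y) (suc k)) ⟩
    suc (a + toℕ y) % suc k              ∎
    where open ≡.≡-Reasoning

  inc^n≡id : ∀ y → (inc ^ suc k) y ≡ y
  inc^n≡id y = toℕ-injective (begin
    toℕ ((inc ^ suc k) y)        ≡⟨ toℕ-inc^ (suc k) y ⟩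
    (suc k + toℕ y) % suc k      ≡⟨ ≡.cong (_% suc k) (+-comm (suc k) (toℕ y)) ⟩
    (toℕ y + suc k) % suc k      ≡⟨ [m+n]%n≡m%n (toℕ y) (suc k) ⟩
    toℕ y % suc k                ≡⟨ m<n⇒m%n≡m (toℕ<n y) ⟩
    toℕ y                        ∎)
    where open ≡.≡-Reasoning

half+half≡odd : ∀ h → suc h + suc (suc h) ≡ suc (suc h * 2)
half+half≡odd = solve-∀

module Toroid (h : ℕ) where
  m : ℕ
  m = suc (suc h * 2)

  open Cyclic (suc h * 2)
  module T = Group (toroidGroup m)
  module TL = GroupLemmas (toroidGroup m)

  σ : List (Fin 3)
  σ = petrieDualGens i1 T.∙ petrieDualGens i2

  -- σ acts by (x , y) ↦ (−1−y , −x), so σ² is the translation (x , y) ↦ (x − 1 , y + 1).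
  act-σ^[2b] : ∀ b x y → act (σ TL.^ (b * 2)) (x , y) ≡ ((dec ^ b) x , (inc ^ b) y)
  act-σ^[2b] zero    x y = ≡.refl
  act-σ^[2b] (suc b) x y rewrite act-σ^[2b] b x y = ≡.refl

  act-σ^m : ∀ x y → act (σ TL.^ m) (x , y) ≡ (opposite ((inc ^ suc h) y) , negF ((dec ^ suc h) x))
  act-σ^m x y = ≡.cong (act σ) (act-σ^[2b] (suc h) x y)

  half-turn : ∀ y → opposite ((inc ^ suc h) (opposite y)) ≡ inc ((inc ^ suc h) y)
  half-turn y = begin
    opposite ((inc ^ suc h) (opposite y))           ≡⟨ opposite∘inc^∘opposite (suc h) y ⟩
    (dec ^ suc h) y                                 ≡⟨ ≡.cong (dec ^ suc h) (≡.sym full-turn) ⟩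
    (dec ^ suc h) ((inc ^ suc h) ((inc ^ suc (suc h)) y)) ≡⟨ dec^∘inc^ (suc h) _ ⟩
    inc ((inc ^ suc h) y)                           ∎
    where
      open ≡.≡-Reasoning
      full-turn : (inc ^ suc h) ((inc ^ suc (suc h)) y) ≡ y
      full-turn = begin
        (inc ^ suc h) ((inc ^ suc (suc h)) y) ≡⟨ ≡.cong-app (^-homo inc (suc h) (suc (suc h))) y ⟨
        (inc ^ (suc h + suc (suc h))) y       ≡⟨ ≡.cong (λ a → (inc ^ a) y) (half+half≡odd h) ⟩
        (inc ^ m) y                           ≡⟨ inc^n≡id y ⟩
        y                                     ∎

  relation : SatisfiesRelation (toroidGroup m) petrieDualGens m
  relation (x , y) = begin
    act ((ρ₀ ++ σ TL.^ m) ++ ρ₀) (x , y)  ≡⟨ act-++ (ρ₀ ++ σ TL.^ m) ρ₀ (x , y) ⟩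
    gen i2 (act (σ TL.^ m) (x , opposite y)) ≡⟨ ≡.cong (gen i2) (act-σ^m x (opposite y)) ⟩
    (opposite ((inc ^ suc h) (opposite y)) , opposite (negF ((dec ^ suc h) x))) ≡⟨ ≡.cong (_, _) (half-turn y) ⟩
    (inc ((inc ^ suc h) y) , opposite (negF ((dec ^ suc h) x))) ≡⟨ ≡.cong (gen i0 ∘ gen i2) (act-σ^m x y) ⟨
    act (ρ₂ ++ σ TL.^ m) (x , y)          ∎
    where
      open ≡.≡-Reasoning
      ρ₀ ρ₂ : List (Fin 3)
      ρ₀ = petrieDualGens i0
      ρ₂ = petrieDualGens i2

  order : ∀ a → σ TL.^ a T.≈ T.ε → 2 * m ∣ a
  order a σᵃ≈ε with even-or-odd a
  ... | b , inj₁ ≡.refl = ≡.subst (2 * m ∣_) (*-comm 2 b) (*-monoʳ-∣ 2 (m%n≡0⇒n∣m b m b%m≡0))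
    where
      inc^b[0]≡0 : (inc ^ b) zero ≡ zero
      inc^b[0]≡0 = ≡.cong proj₂ (≡.trans (≡.sym (act-σ^[2b] b zero zero)) (σᵃ≈ε (zero , zero)))
      b%m≡0 : b % m ≡ 0
      b%m≡0 = ≡.trans (≡.cong (_% m) (≡.sym (+-identityʳ b)))
                (≡.trans (≡.sym (toℕ-inc^ b zero)) (≡.cong toℕ inc^b[0]≡0))
  ... | b , inj₂ ≡.refl with ≡.trans (≡.sym (first-coordinate zero)) (first-coordinate (suc zero))
    where
      first-coordinate : ∀ x → opposite ((inc ^ b) zero) ≡ x
      first-coordinate x = ≡.cong proj₁
        (≡.trans (≡.sym (≡.cong (act σ) (act-σ^[2b] b x zero))) (σᵃ≈ε (x , zero)))
  ... | ()

  ρ₁≉ε : ¬ petrieDualGens i1 T.≈ T.ε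
  ρ₁≉ε ρ₁≈ε with ≡.cong proj₁ (ρ₁≈ε (zero , suc zero))
  ... | ()

  ρ₂≉ε : ¬ petrieDualGens i2 T.≈ T.ε
  ρ₂≉ε ρ₂≈ε with ≡.cong proj₂ (ρ₂≈ε (zero , zero))
  ... | ()

cover⇒isomorphic : ∀ {c ℓ c′ ℓ′} (P : RegularPolyhedron c ℓ) (p m : ℕ) →
  IsOfType (Γ P) (ρ P) p (2 * m) → SatisfiesRelation (Γ P) (ρ P) m →
  (Q : RegularPolyhedron c′ ℓ′) → Covers (Γ Q) (ρ Q) (Γ P) (ρ P) →
  (n : ℕ) → NumVertices (Γ P) (ρ P) n → NumVertices (Γ Q) (ρ Q) n →
  Isomorphic (Γ Q) (ρ Q) (Γ P) (ρ P)
cover⇒isomorphic P _ m (_ , σ-order) relation Q (F , covering) _ verticesP verticesQ =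
  trivial-kernel⇒Isomorphic generated
    (kernel-trivial m (λ a → GroupLemmas.order-divides (Γ P) σ-order) (nontrivial i1) (nontrivial i2)
      relation (kernel⊆vertexStabiliser generated verticesQ verticesP))
  where
    open Covering F covering (IsStringC.involution {G = Γ Q} (isPoly Q))
    open IsStringC (isPoly P) using (nontrivial) renaming (generates to generated)

toroidπδ-quotient⇒faithful : ∀ {c ℓ} (h : ℕ) (Q : RegularPolyhedron c ℓ) →
  VertexFaithfulQuotientIs (Γ Q) (ρ Q) (toroidGroup (Toroid.m h)) petrieDualGens →
  VertexFaithful (Γ Q) (ρ Q)
toroidπδ-quotient⇒faithful h Q (F , covering , F-kernel) g g∈vertexKernel =
  kernel-trivial m order ρ₁≉ε ρ₂≉ε relation kernel⊆V g (proj₂ (F-kernel g) g∈vertexKernel)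
  where
    open Toroid h
    open Covering {ρP = petrieDualGens} F covering (IsStringC.involution {G = Γ Q} (isPoly Q))

    kernel⊆V : ∀ g → F g T.≈ T.ε → InSub (Γ Q) (ρ Q) (V₁₂ (Γ Q)) g
    kernel⊆V g Fg≈ε = Words.vertexKernel⊆vertexStabiliser (Γ Q) (ρ Q) (proj₁ (F-kernel g) Fg≈ε)

lemma3p3 : ∀ {c ℓ c′ ℓ′} →
    ( (P : RegularPolyhedron c ℓ) (p m : ℕ) →
      Finite (Γ P) → ¬ Flat (Γ P) (ρ P) → VertexFaithful (Γ P) (ρ P) →
      IsOfType (Γ P) (ρ P) p (2 * m) → SatisfiesRelation (Γ P) (ρ P) m →
      (Q : RegularPolyhedron c′ ℓ′) → Covers (Γ Q) (ρ Q) (Γ P) (ρ P) →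
      (n : ℕ) → NumVertices (Γ P) (ρ P) n → NumVertices (Γ Q) (ρ Q) n →
      Isomorphic (Γ Q) (ρ Q) (Γ P) (ρ P) )
    ×
    ( (m : ℕ) → 3 ≤ m → m % 2 ≡ 1 →
      ¬ (Σ (RegularPolyhedron c′ ℓ′) (λ Q →
           ¬ VertexFaithful (Γ Q) (ρ Q)
         × VertexFaithfulQuotientIs (Γ Q) (ρ Q) (toroidGroup m) petrieDualGens)) )
lemma3p3 = (λ P p m _ _ _ → cover⇒isomorphic P p m) , no-unfaithful-cover
  where
    no-unfaithful-cover : ∀ {c ℓ} (m : ℕ) → 3 ≤ m → m % 2 ≡ 1 →
      ¬ (Σ (RegularPolyhedron c ℓ) (λ Q →
           ¬ VertexFaithful (Γ Q) (ρ Q)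
         × VertexFaithfulQuotientIs (Γ Q) (ρ Q) (toroidGroup m) petrieDualGens))
    no-unfaithful-cover m _ _ _ with even-or-odd m
    no-unfaithful-cover _ _ m%2≡1 _ | b , inj₁ ≡.refl =
      contradiction (≡.trans (≡.sym (m*n%n≡0 b 2)) m%2≡1) (λ ())
    no-unfaithful-cover _ (s≤s ()) _ _ | zero , inj₂ ≡.refl
    no-unfaithful-cover _ _ _ (Q , unfaithful , quotient) | suc h , inj₂ ≡.refl =
      unfaithful (toroidπδ-quotient⇒faithful h Q quotient)
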